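{- For non-negative integers $n$ and $k$, not both equal to $0$, $$(1-q)^{n-k}\cdot S_q[n,k]=\sum_{j=0}^{n-k}(-q)^j\binom{n-1}{n-k-j}\begin{bmatrix} j+k-1\\ j\end{bmatrix}_q .$$
   Context: For $k\ge1$, $[k]_q=1+q+\cdots+q^{k-1}$, $[0]_q=0$, $[k]_q!=[1]_q[2]_q\cdots[k]_q$ (with $[0]_q!=1$), and the $q$-binomial coefficient is $\begin{bmatrix} a\\ b\end{bmatrix}_q=\frac{[a]_q!}{[b]_q!\,[a-b]_q!}$ for $0\le b\le a$, and $0$ otherwise except that $\begin{bmatrix} a\\ 0\end{bmatrix}_q=1$. The $q$-Stirling numbers of the second kind are defined by $S_q[n,0]=\delta_{n,0}$, $S_q[0,k]=\delta_{0,k}$ and $S_q[n,k]=S_q[n-1,k-1]+[k]_q S_q[n-1,k]$ for $n,k\ge1$; equivalently $S_q[n,k]=\sum_{w\in RG(n,k)}q^{\sum_i(w_i-1)-\binom k2}$, where $RG(n,k)$ is the set of words $w_1\cdots w_n$ of positive integers with maximal entry $k$ such that $w_i\le\max(0,w_1,\dots,w_{i-1})+1$ for all $i$. In particular $S_q[n,k]=0$ for $k>n$. The binomial coefficient $\binom{a}{b}$ is $0$ unless $0\le b\le a$. -}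

module Defs where

open import Level using (Level)
import Data.Nat
open import Data.Nat using (ℕ; zero; suc; _∸_)
open import Data.Nat.Combinatorics using (_C_)
open import Algebra.Bundles using (CommutativeRing)

-- All q-analogues are evaluated at an arbitrary element q of an arbitrary
-- commutative ring R.  Taking R = ℤ[q] and q the indeterminate recovers the
-- polynomial identity; conversely a polynomial identity over ℤ holds under
-- every such evaluation.
module QDefs {c ℓ : Level} (R : CommutativeRing c ℓ) where
  open CommutativeRing R

  pow : Carrier → ℕ → Carrier
  pow x zero    = 1#
  pow x (suc n) = x * pow x n

  fromℕ : ℕ → Carrier
  fromℕ zero    = 0#
  fromℕ (suc n) = 1# + fromℕ n

  sumTo : ℕ → (ℕ → Carrier) → Carrier
  sumTo zero    f = f 0
  sumTo (suc m) f = sumTo m f + f (suc m)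

  qint : Carrier → ℕ → Carrier
  qint q zero    = 0#
  qint q (suc k) = qint q k + pow q k

  -- q-binomial coefficient [a choose b]_q, via the q-Pascal recurrence
  -- [a+1, b+1] = [a, b] + q^{b+1} [a, b+1];  [a,0] = 1; [0,b+1] = 0
  -- (equals [a]!/([b]![a-b]!) for 0 ≤ b ≤ a and 0 for b > a)
  qbin : Carrier → ℕ → ℕ → Carrier
  qbin q a       zero    = 1#
  qbin q zero    (suc b) = 0#
  qbin q (suc a) (suc b) = qbin q a b + pow q (suc b) * qbin q a (suc b)

  Sq : Carrier → ℕ → ℕ → Carrier
  Sq q zero    zero    = 1#
  Sq q zero    (suc k) = 0#
  Sq q (suc n) zero    = 0#
  Sq q (suc n) (suc k) = Sq q n k + qint q (suc k) * Sq q n (suc k)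

  thmLHS : Carrier → ℕ → ℕ → Carrier
  thmLHS q n k = pow (1# - q) (n ∸ k) * Sq q n k

  thmRHS : Carrier → ℕ → ℕ → Carrier
  thmRHS q n k = sumTo (n ∸ k) (λ j →
    pow (- q) j * (fromℕ ((n ∸ 1) C ((n ∸ k) ∸ j)) * qbin q ((j Data.Nat.+ k) ∸ 1) j))

-- Write T(N, m, k) for the right-hand side with N = n - 1 and m = n - k.  Both
-- sides satisfy the same recurrence: by the q-Stirling recurrence and
-- (1 - q)[k+1]_q = 1 - q^{k+1},
--   L(n+1, k+1) = L(n, k) + (1 - q^{k+1}) L(n, k+1)   for L(n, k) = (1-q)^{n-k} S_q[n,k],
-- while Pascal's rule for binomial(N, m - j) and the dual q-Pascal rule for
-- [j+k-1 choose j]_q give the same relation for T.  The boundary values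
-- k = 0 and k = n agree, so induction on n finishes the proof.
module Submission where

open import Defs
open import Level using (Level)
open import Data.Nat using (ℕ; zero; suc; _∸_; _≤_; _<_; s≤s; z≤n)
import Data.Nat as ℕ
import Data.Nat.Properties as ℕₚ
open import Data.Nat.Combinatorics using (_C_; nCk+nC[k+1]≡[n+1]C[k+1])
open import Data.Nat.Combinatorics.Specification using (k>n⇒nCk≡0)
open import Data.Product using (_×_; _,_)
open import Data.Empty using (⊥-elim)
open import Relation.Binary.PropositionalEquality as ≡ using (_≡_)
open import Relation.Nullary using (¬_)
open import Algebra.Bundles using (CommutativeRing)
import Algebra.Properties.CommutativeSemigroup as CommutativeSemigroupProperties
import Algebra.Solver.Ring.NaturalCoefficients.Default as NaturalCoefficientsSolver
import Relation.Binary.Reasoning.Setoid as SetoidReasoning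

module SumProperties {c ℓ : Level} (R : CommutativeRing c ℓ) where
  open CommutativeRing R hiding (zero)
  open QDefs R
  open CommutativeSemigroupProperties +-commutativeSemigroup using (interchange)

  fromℕ-+ : ∀ m n → fromℕ (m ℕ.+ n) ≈ fromℕ m + fromℕ n
  fromℕ-+ zero    n = sym (+-identityˡ _)
  fromℕ-+ (suc m) n = trans (+-congˡ (fromℕ-+ m n)) (sym (+-assoc _ _ _))

  sumTo-cong : ∀ m {f g : ℕ → Carrier} → (∀ j → j ≤ m → f j ≈ g j) → sumTo m f ≈ sumTo m g
  sumTo-cong zero    f≈g = f≈g 0 z≤n
  sumTo-cong (suc m) f≈g =
    +-cong (sumTo-cong m (λ j j≤m → f≈g j (ℕₚ.m≤n⇒m≤1+n j≤m))) (f≈g (suc m) ℕₚ.≤-refl)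

  sumTo-+ : ∀ m (f g : ℕ → Carrier) → sumTo m (λ j → f j + g j) ≈ sumTo m f + sumTo m g
  sumTo-+ zero    f g = refl
  sumTo-+ (suc m) f g = trans (+-congʳ (sumTo-+ m f g)) (interchange _ _ _ _)

  sumTo-*ˡ : ∀ m a (f : ℕ → Carrier) → sumTo m (λ j → a * f j) ≈ a * sumTo m f
  sumTo-*ˡ zero    a f = refl
  sumTo-*ˡ (suc m) a f = trans (+-congʳ (sumTo-*ˡ m a f)) (sym (distribˡ _ _ _))

  sumTo-suc : ∀ m (f : ℕ → Carrier) → sumTo (suc m) f ≈ f 0 + sumTo m (λ j → f (suc j))
  sumTo-suc zero    f = refl
  sumTo-suc (suc m) f = trans (+-congʳ (sumTo-suc m f)) (+-assoc _ _ _)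

  sumTo-zero : ∀ m (f : ℕ → Carrier) → (∀ j → f j ≈ 0#) → sumTo m f ≈ 0#
  sumTo-zero zero    f f≈0 = f≈0 0
  sumTo-zero (suc m) f f≈0 = trans (+-cong (sumTo-zero m f f≈0) (f≈0 (suc m))) (+-identityʳ 0#)

module QStirling {c ℓ : Level} (R : CommutativeRing c ℓ) (q : CommutativeRing.Carrier R) where
  open CommutativeRing R hiding (zero)
  open QDefs R
  open SumProperties R
  open SetoidReasoning setoid
  open NaturalCoefficientsSolver commutativeSemiring
  open CommutativeSemigroupProperties +-commutativeSemigroup using (xy∙z≈xz∙y)

  qbin-vanishes : ∀ {a b} → a < b → qbin q a b ≈ 0#
  qbin-vanishes {zero}  {suc b} _         = refl
  qbin-vanishes {suc a} {suc b} (s≤s a<b) =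
    trans (+-cong (qbin-vanishes a<b) (*-congˡ (qbin-vanishes (ℕₚ.m<n⇒m<1+n a<b))))
          (trans (+-identityˡ _) (zeroʳ _))

  Sq-vanishes : ∀ {n k} → n < k → Sq q n k ≈ 0#
  Sq-vanishes {zero}  {suc k} _         = refl
  Sq-vanishes {suc n} {suc k} (s≤s n<k) =
    trans (+-cong (Sq-vanishes n<k) (*-congˡ (Sq-vanishes (ℕₚ.m<n⇒m<1+n n<k))))
          (trans (+-identityˡ _) (zeroʳ _))

  Sq-diag : ∀ n → Sq q n n ≈ 1#
  Sq-diag zero    = refl
  Sq-diag (suc n) =
    trans (+-cong (Sq-diag n) (*-congˡ (Sq-vanishes {n} ℕₚ.≤-refl)))
          (trans (+-congˡ (zeroʳ _)) (+-identityʳ 1#))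

  [1-q]*qint : ∀ k → (1# - q) * qint q (suc k) ≈ 1# + - q * pow q k
  [1-q]*qint zero    = solve 1 (λ x → (con 1 :+ x) :* (con 0 :+ con 1) := con 1 :+ x :* con 1) refl (- q)
  [1-q]*qint (suc k) = begin
    (1# + - q) * (qint q (suc k) + q * pow q k)
      ≈⟨ solve 4 (λ x y i p → (con 1 :+ x) :* (i :+ y :* p) := (con 1 :+ x) :* i :+ (y :* p :+ x :* (y :* p)))
                 refl (- q) q (qint q (suc k)) (pow q k) ⟩
    (1# + - q) * qint q (suc k) + (q * pow q k + - q * (q * pow q k))
      ≈⟨ +-congʳ ([1-q]*qint k) ⟩
    1# + - q * pow q k + (q * pow q k + - q * (q * pow q k))
      ≈⟨ solve 4 (λ x y p z → con 1 :+ x :* p :+ (y :* p :+ z) := con 1 :+ (x :+ y) :* p :+ z)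
                 refl (- q) q (pow q k) (- q * (q * pow q k)) ⟩
    1# + (- q + q) * pow q k + - q * (q * pow q k)
      ≈⟨ +-congʳ (+-congˡ (trans (*-congʳ (-‿inverseˡ q)) (zeroˡ _))) ⟩
    1# + 0# + - q * (q * pow q k)
      ≈⟨ +-congʳ (+-identityʳ 1#) ⟩
    1# + - q * pow q (suc k) ∎

  -- Dual of the defining q-Pascal recurrence: the power of q sits on the other term.
  qbin-pascal′ : ∀ b d → qbin q (suc (b ℕ.+ d)) (suc b) ≈ pow q d * qbin q (b ℕ.+ d) b + qbin q (b ℕ.+ d) (suc b)
  qbin-pascal′ zero    zero    = solve 1 (λ x → con 1 :+ x :* con 0 := con 1 :* con 1 :+ con 0) refl (pow q 1)
  qbin-pascal′ zero    (suc d) = begin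
    1# + pow q 1 * qbin q (suc d) 1
      ≈⟨ +-congˡ (*-congˡ (qbin-pascal′ zero d)) ⟩
    1# + pow q 1 * (pow q d * 1# + qbin q d 1)
      ≈⟨ solve 3 (λ x p y → con 1 :+ (x :* con 1) :* (p :* con 1 :+ y) := x :* p :* con 1 :+ (con 1 :+ (x :* con 1) :* y))
                 refl q (pow q d) (qbin q d 1) ⟩
    q * pow q d * 1# + (1# + pow q 1 * qbin q d 1) ∎
  qbin-pascal′ (suc b) zero    = begin
    Y + pow q (suc (suc b)) * Z ≈⟨ +-congˡ (trans (*-congˡ Z≈0) (zeroʳ _)) ⟩
    Y + 0#                      ≈⟨ +-cong (sym (*-identityˡ Y)) (sym Z≈0) ⟩
    1# * Y + Z                  ∎
    where
    Y = qbin q (suc (b ℕ.+ 0)) (suc b)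
    Z = qbin q (suc (b ℕ.+ 0)) (suc (suc b))
    Z≈0 : Z ≈ 0#
    Z≈0 = qbin-vanishes (s≤s (s≤s (ℕₚ.≤-reflexive (ℕₚ.+-identityʳ b))))
  qbin-pascal′ (suc b) (suc d) = begin
    qbin q (suc (b ℕ.+ suc d)) (suc b) + q * Q * qbin q (suc (b ℕ.+ suc d)) (suc (suc b))
      ≈⟨ +-cong (qbin-pascal′ b (suc d)) (*-congˡ shifted) ⟩
    (q * P * X + Y) + q * Q * (P * Y + Z)
      ≈⟨ solve 6 (λ x p q′ u y z → (x :* p :* u :+ y) :+ x :* q′ :* (p :* y :+ z)
                                := x :* p :* (u :+ q′ :* y) :+ (y :+ x :* q′ :* z))
                 refl q P Q X Y Z ⟩
    q * P * (X + Q * Y) + (Y + q * Q * Z) ∎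
    where
    P = pow q d
    Q = pow q (suc b)
    X = qbin q (b ℕ.+ suc d) b
    Y = qbin q (b ℕ.+ suc d) (suc b)
    Z = qbin q (b ℕ.+ suc d) (suc (suc b))
    shifted : qbin q (suc (b ℕ.+ suc d)) (suc (suc b)) ≈ P * Y + Z
    shifted = ≡.subst (λ a → qbin q (suc a) (suc (suc b)) ≈ P * qbin q a (suc b) + qbin q a (suc (suc b)))
                      (≡.sym (ℕₚ.+-suc b d)) (qbin-pascal′ (suc b) d)

  -- thmRHS q (suc N) k is binomialSum N (suc N ∸ k) k.
  summand : ℕ → ℕ → ℕ → ℕ → Carrier
  summand N m k j = pow (- q) j * (fromℕ (N C (m ∸ j)) * qbin q ((j ℕ.+ k) ∸ 1) j)

  binomialSum : ℕ → ℕ → ℕ → Carrier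
  binomialSum N m k = sumTo m (summand N m k)

  summand-pascal : ∀ N m k j → j ≤ m → summand (suc N) (suc m) k j ≈ summand N (suc m) k j + summand N m k j
  summand-pascal N m k j j≤m
    rewrite ℕₚ.+-∸-assoc 1 j≤m | ≡.sym (nCk+nC[k+1]≡[n+1]C[k+1] N (m ∸ j)) =
    trans (*-congˡ (*-congʳ (fromℕ-+ (N C (m ∸ j)) (N C suc (m ∸ j)))))
      (solve 4 (λ p a b y → p :* ((a :+ b) :* y) := p :* (b :* y) :+ p :* (a :* y))
        refl (pow (- q) j) (fromℕ (N C (m ∸ j))) (fromℕ (N C suc (m ∸ j))) (qbin q ((j ℕ.+ k) ∸ 1) j))

  binomialSum-pascal : ∀ N m k → binomialSum (suc N) (suc m) k ≈ binomialSum N (suc m) k + binomialSum N m k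
  binomialSum-pascal N m k = begin
    sumTo m (summand (suc N) (suc m) k) + summand (suc N) (suc m) k (suc m)
      ≈⟨ +-cong (sumTo-cong m (summand-pascal N m k)) last ⟩
    sumTo m (λ j → summand N (suc m) k j + summand N m k j) + summand N (suc m) k (suc m)
      ≈⟨ +-congʳ (sumTo-+ m (summand N (suc m) k) (summand N m k)) ⟩
    sumTo m (summand N (suc m) k) + binomialSum N m k + summand N (suc m) k (suc m)
      ≈⟨ xy∙z≈xz∙y _ _ _ ⟩
    binomialSum N (suc m) k + binomialSum N m k ∎
    where
    last : summand (suc N) (suc m) k (suc m) ≈ summand N (suc m) k (suc m)
    last rewrite ℕₚ.n∸n≡0 m = refl

  summand-qpascal : ∀ N m k i →
    summand N (suc m) (suc k) (suc i) ≈ summand N (suc m) k (suc i) + (- q * pow q k) * summand N m (suc k) i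
  summand-qpascal N m k i rewrite ℕₚ.+-suc i k = begin
    - q * P * (B * qbin q (suc (i ℕ.+ k)) (suc i))
      ≈⟨ *-congˡ (*-congˡ (qbin-pascal′ i k)) ⟩
    - q * P * (B * (pow q k * X + Y))
      ≈⟨ solve 6 (λ x p b qk u y → x :* p :* (b :* (qk :* u :+ y)) := x :* p :* (b :* y) :+ (x :* qk) :* (p :* (b :* u)))
                 refl (- q) P B (pow q k) X Y ⟩
    - q * P * (B * Y) + (- q * pow q k) * (P * (B * X)) ∎
    where
    P = pow (- q) i
    B = fromℕ (N C (m ∸ i))
    X = qbin q (i ℕ.+ k) i
    Y = qbin q (i ℕ.+ k) (suc i)

  binomialSum-qpascal : ∀ N m k →
    binomialSum N (suc m) (suc k) ≈ binomialSum N (suc m) k + (- q * pow q k) * binomialSum N m (suc k)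
  binomialSum-qpascal N m k = begin
    binomialSum N (suc m) (suc k)
      ≈⟨ sumTo-suc m (summand N (suc m) (suc k)) ⟩
    s₀ + sumTo m (λ i → summand N (suc m) (suc k) (suc i))
      ≈⟨ +-congˡ (sumTo-cong m (λ i _ → summand-qpascal N m k i)) ⟩
    s₀ + sumTo m (λ i → summand N (suc m) k (suc i) + (- q * pow q k) * summand N m (suc k) i)
      ≈⟨ +-congˡ (trans (sumTo-+ m _ _) (+-congˡ (sumTo-*ˡ m (- q * pow q k) (summand N m (suc k))))) ⟩
    s₀ + (sumTo m (λ i → summand N (suc m) k (suc i)) + (- q * pow q k) * binomialSum N m (suc k))
      ≈⟨ sym (+-assoc _ _ _) ⟩
    s₀ + sumTo m (λ i → summand N (suc m) k (suc i)) + (- q * pow q k) * binomialSum N m (suc k)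
      ≈⟨ +-congʳ (sym (sumTo-suc m (summand N (suc m) k))) ⟩
    binomialSum N (suc m) k + (- q * pow q k) * binomialSum N m (suc k) ∎
    where
    s₀ : Carrier
    s₀ = summand N (suc m) k 0

  stirling-identity : ∀ N m k → m ℕ.+ k ≡ suc N → pow (1# - q) m * Sq q (suc N) k ≈ binomialSum N m k
  stirling-identity N zero k ≡.refl = begin
    1# * Sq q (suc N) (suc N) ≈⟨ *-congˡ (Sq-diag (suc N)) ⟩
    1# * 1#                   ≈⟨ *-congˡ (sym (trans (*-identityʳ _) (+-identityʳ 1#))) ⟩
    binomialSum N zero (suc N) ∎
  stirling-identity N (suc m) zero eq = trans (zeroʳ _) (sym (sumTo-zero (suc m) (summand N (suc m) zero) vanishes))
    where
    vanishes : ∀ j → summand N (suc m) zero j ≈ 0#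
    vanishes zero    = trans (*-congˡ (*-congʳ (reflexive (≡.cong fromℕ (k>n⇒nCk≡0 N<1+m)))))
                             (trans (*-congˡ (zeroˡ _)) (zeroʳ _))
      where
      N<1+m : N < suc m
      N<1+m = s≤s (ℕₚ.≤-reflexive (≡.trans (ℕₚ.suc-injective (≡.sym eq)) (ℕₚ.+-identityʳ m)))
    vanishes (suc i) = trans (*-congˡ (*-congˡ (qbin-vanishes (s≤s (ℕₚ.≤-reflexive (ℕₚ.+-identityʳ i))))))
                             (trans (*-congˡ (zeroʳ _)) (zeroʳ _))
  stirling-identity zero (suc m) (suc k) eq = ⊥-elim (ℕₚ.m+1+n≢0 m (ℕₚ.suc-injective eq))
  stirling-identity (suc N) (suc m) (suc k) eq = begin
    (1# + - q) * E * (S₁ + K * S₂)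
      ≈⟨ solve 5 (λ x e s₁ κ s₂ → (con 1 :+ x) :* e :* (s₁ :+ κ :* s₂) := (con 1 :+ x) :* e :* s₁ :+ ((con 1 :+ x) :* κ) :* (e :* s₂))
                 refl (- q) E S₁ K S₂ ⟩
    (1# + - q) * E * S₁ + ((1# + - q) * K) * (E * S₂)
      ≈⟨ +-cong ih₁ (*-cong ([1-q]*qint k) ih₂) ⟩
    T₁ + (1# + - q * pow q k) * T₂
      ≈⟨ solve 4 (λ t₁ x p t₂ → t₁ :+ (con 1 :+ x :* p) :* t₂ := (t₁ :+ (x :* p) :* t₂) :+ t₂) refl T₁ (- q) (pow q k) T₂ ⟩
    (T₁ + (- q * pow q k) * T₂) + T₂
      ≈⟨ +-congʳ (sym (binomialSum-qpascal N m k)) ⟩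
    binomialSum N (suc m) (suc k) + T₂
      ≈⟨ sym (binomialSum-pascal N m (suc k)) ⟩
    binomialSum (suc N) (suc m) (suc k) ∎
    where
    E  = pow (1# - q) m
    S₁ = Sq q (suc N) k
    S₂ = Sq q (suc N) (suc k)
    K  = qint q (suc k)
    T₁ = binomialSum N (suc m) k
    T₂ = binomialSum N m (suc k)
    m+1+k≡1+N : m ℕ.+ suc k ≡ suc N
    m+1+k≡1+N = ℕₚ.suc-injective eq
    ih₁ : pow (1# - q) (suc m) * S₁ ≈ T₁
    ih₁ = stirling-identity N (suc m) k (≡.trans (≡.sym (ℕₚ.+-suc m k)) m+1+k≡1+N)
    ih₂ : E * S₂ ≈ T₂
    ih₂ = stirling-identity N m (suc k) m+1+k≡1+N

theorem9p1 : {c ℓ : Level} (R : CommutativeRing c ℓ) (q : CommutativeRing.Carrier R) (n k : ℕ) →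
    ¬ (n ≡ 0 × k ≡ 0) →
    (k ≤ n → CommutativeRing._≈_ R (QDefs.thmLHS R q n k) (QDefs.thmRHS R q n k))
    × (n < k → CommutativeRing._≈_ R (QDefs.Sq R q n k) (CommutativeRing.0# R))
theorem9p1 R q zero    k nz = (λ k≤0 → ⊥-elim (nz (≡.refl , ℕₚ.n≤0⇒n≡0 k≤0))) , QStirling.Sq-vanishes R q
theorem9p1 R q (suc N) k nz =
  (λ k≤n → QStirling.stirling-identity R q N (suc N ∸ k) k (ℕₚ.m∸n+n≡m k≤n)) , QStirling.Sq-vanishes R q
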